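{- If a $3$-partite $3$-graph $\mathcal{H}$ has a home-base partition $(\mathcal{F},\mathcal{R},W)$, then $\tau(\mathcal{H}) = 2\nu(\mathcal{H})$.
   Context: A hypergraph $\mathcal{H}$ has a finite vertex set and a multiset of edges (subsets of vertices); two edges are parallel if they are the same vertex subset. A $3$-partite $3$-graph has its vertex set partitioned into classes $V_1,V_2,V_3$ with every edge containing exactly one vertex from each class. $\nu$ is the matching number (maximum number of pairwise disjoint edges), $\tau$ the vertex cover number. $\mathcal{H}|_U$ is the hypergraph of all edges (with multiplicity) contained in $U$. The truncated Fano plane is the $3$-graph on $\{a,b,c,x,y,z\}$ with edges $abc, ayz, xbz, xyc$ (classes $\{a,x\},\{b,y\},\{c,z\}$); a truncated multi-Fano plane is obtained from it by adding any number of edges parallel to existing ones. An FR-partition of $\mathcal{H}$ is a triple $(\mathcal{F},\mathcal{R},W)$ with: (1) $\mathcal{F}\cup\mathcal{R}\cup\{W\}$ a partition of $V(\mathcal{H})$; (2) $\mathcal{H}|_F$ isomorphic to a truncated multi-Fano plane for each $F\in\mathcal{F}$; (3) each $R\in\mathcal{R}$ a $3$-set with one vertex in each class; (4) $|\mathcal{F}\cup\mathcal{R}|=\nu(\mathcal{H})$. $B_i$ is the bipartite graph with classes $\mathcal{R}$ and $W\cap V_i$, $R\sim w$ iff some edge contains $w$ and two vertices of $R$; the FR-partition is matchable if every $B_i$ has a matching saturating $\mathcal{R}$. Edge-home property: every edge lies in $\mathcal{H}|_F$ for some $F\in\mathcal{F}$ or contains two vertices of some $R\in\mathcal{R}$.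 A home-base partition is a matchable FR-partition with the edge-home property. -}

module Defs where

open import Data.Nat using (ℕ; _+_; _*_; _≤_)
open import Data.Fin using (Fin)
open import Data.Fin.Subset using (Subset; _∈_; _∉_; ∣_∣)
open import Data.Product using (_×_; Σ; ∃; ∃-syntax; _,_)
open import Data.Sum using (_⊎_)
open import Data.List using (List; []; _∷_; length; lookup)
import Data.List.Membership.Propositional as LM
open import Data.List.Relation.Unary.All using (All)
open import Data.List.Relation.Unary.AllPairs using (AllPairs)
open import Relation.Binary.PropositionalEquality using (_≡_; _≢_)
open import Function.Definitions using (Injective)

-- A 3-partite 3-graph with vertex classes V₁ = Fin n₁, V₂ = Fin n₂, V₃ = Fin n₃.
-- An edge is a triple (one vertex from each class); the edge multiset is a list.
Edge : ℕ → ℕ → ℕ → Set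
Edge n₁ n₂ n₃ = Fin n₁ × Fin n₂ × Fin n₃

record Hypergraph : Set where
  constructor hyp
  field
    n₁ n₂ n₃ : ℕ
    edges    : List (Edge n₁ n₂ n₃)

module _ {n₁ n₂ n₃ : ℕ} where

  data Vtx : Set where
    v₁ : Fin n₁ → Vtx
    v₂ : Fin n₂ → Vtx
    v₃ : Fin n₃ → Vtx

  _∈ₑ_ : Vtx → Edge n₁ n₂ n₃ → Set
  v₁ u ∈ₑ (e₁ , e₂ , e₃) = u ≡ e₁
  v₂ u ∈ₑ (e₁ , e₂ , e₃) = u ≡ e₂
  v₃ u ∈ₑ (e₁ , e₂ , e₃) = u ≡ e₃

  VSet : Set
  VSet = Subset n₁ × Subset n₂ × Subset n₃

  _∈ᵥ_ : Vtx → VSet → Set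
  v₁ u ∈ᵥ (S₁ , S₂ , S₃) = u ∈ S₁
  v₂ u ∈ᵥ (S₁ , S₂ , S₃) = u ∈ S₂
  v₃ u ∈ᵥ (S₁ , S₂ , S₃) = u ∈ S₃

  size : VSet → ℕ
  size (S₁ , S₂ , S₃) = ∣ S₁ ∣ + ∣ S₂ ∣ + ∣ S₃ ∣

  DisjointE : Edge n₁ n₂ n₃ → Edge n₁ n₂ n₃ → Set
  DisjointE (e₁ , e₂ , e₃) (f₁ , f₂ , f₃) = e₁ ≢ f₁ × e₂ ≢ f₂ × e₃ ≢ f₃

  IsMatching : List (Edge n₁ n₂ n₃) → List (Edge n₁ n₂ n₃) → Set
  IsMatching E M = All (LM._∈ E) M × AllPairs DisjointE M

  IsMatchingNumber : List (Edge n₁ n₂ n₃) → ℕ → Set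
  IsMatchingNumber E k =
    (∃[ M ] (IsMatching E M × length M ≡ k)) ×
    (∀ M → IsMatching E M → length M ≤ k)

  IsCover : List (Edge n₁ n₂ n₃) → VSet → Set
  IsCover E C = ∀ e → e LM.∈ E → ∃[ v ] (v ∈ₑ e × v ∈ᵥ C)

  IsCoverNumber : List (Edge n₁ n₂ n₃) → ℕ → Set
  IsCoverNumber E k =
    (∃[ C ] (IsCover E C × size C ≡ k)) ×
    (∀ C → IsCover E C → k ≤ size C)

  -- A 6-set F = {a,x} ∪ {b,y} ∪ {c,z} with {a,x} ⊆ V₁, {b,y} ⊆ V₂, {c,z} ⊆ V₃,
  -- labelled as in the truncated Fano plane.
  record FBlock : Set where
    constructor fblock
    field
      a x : Fin n₁
      b y : Fin n₂
      c z : Fin n₃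

  open FBlock

  vertsF : FBlock → List Vtx
  vertsF F = v₁ (a F) ∷ v₁ (x F) ∷ v₂ (b F) ∷ v₂ (y F) ∷ v₃ (c F) ∷ v₃ (z F) ∷ []

  _⊆F_ : Edge n₁ n₂ n₃ → FBlock → Set
  (e₁ , e₂ , e₃) ⊆F F =
    (e₁ ≡ a F ⊎ e₁ ≡ x F) × (e₂ ≡ b F ⊎ e₂ ≡ y F) × (e₃ ≡ c F ⊎ e₃ ≡ z F)

  fanoEdges : FBlock → List (Edge n₁ n₂ n₃)
  fanoEdges F = (a F , b F , c F) ∷ (a F , y F , z F) ∷ (x F , b F , z F) ∷ (x F , y F , c F) ∷ []

  IsMultiFano : List (Edge n₁ n₂ n₃) → FBlock → Set
  IsMultiFano E F =
    a F ≢ x F × b F ≢ y F × c F ≢ z F ×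
    (∀ e → e LM.∈ E → e ⊆F F → e LM.∈ fanoEdges F) ×
    All (LM._∈ E) (fanoEdges F)

  -- R-blocks: 3-sets with one vertex in each class
  vertsR : Edge n₁ n₂ n₃ → List Vtx
  vertsR (r₁ , r₂ , r₃) = v₁ r₁ ∷ v₂ r₂ ∷ v₃ r₃ ∷ []

  TwoOf : Edge n₁ n₂ n₃ → Edge n₁ n₂ n₃ → Set
  TwoOf (e₁ , e₂ , e₃) (r₁ , r₂ , r₃) =
    (e₁ ≡ r₁ × e₂ ≡ r₂) ⊎ (e₁ ≡ r₁ × e₃ ≡ r₃) ⊎ (e₂ ≡ r₂ × e₃ ≡ r₃)

  -- the blocks of 𝓕 ∪ 𝓡 as vertex lists (indexed, so multiplicities count)
  blocks : List FBlock → List (Edge n₁ n₂ n₃) → List (List Vtx)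
  blocks [] 𝓡 = Data.List.map vertsR 𝓡
    where import Data.List
  blocks (F ∷ 𝓕) 𝓡 = vertsF F ∷ blocks 𝓕 𝓡

  IsPartition : List FBlock → List (Edge n₁ n₂ n₃) → VSet → Set
  IsPartition 𝓕 𝓡 W =
    (∀ v → (∃[ i ] (v LM.∈ lookup (blocks 𝓕 𝓡) i)) ⊎ v ∈ᵥ W) ×
    (∀ i j → i ≢ j → ∀ v → v LM.∈ lookup (blocks 𝓕 𝓡) i → v LM.∈ lookup (blocks 𝓕 𝓡) j → Data.Empty.⊥) ×
    (∀ i v → v LM.∈ lookup (blocks 𝓕 𝓡) i → v ∈ᵥ W → Data.Empty.⊥)
    where import Data.Empty

  IsFRPartition : List (Edge n₁ n₂ n₃) → List FBlock → List (Edge n₁ n₂ n₃) → VSet → Set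
  IsFRPartition E 𝓕 𝓡 W =
    IsPartition 𝓕 𝓡 W ×
    All (IsMultiFano E) 𝓕 ×
    (∀ k → IsMatchingNumber E k → length 𝓕 + length 𝓡 ≡ k)

  -- adjacency in B_i: R ~ w iff some edge contains w and two vertices of R
  Adj : List (Edge n₁ n₂ n₃) → Edge n₁ n₂ n₃ → Vtx → Set
  Adj E R w = ∃[ e ] (e LM.∈ E × w ∈ₑ e × TwoOf e R)

  -- B_i has a matching saturating 𝓡 (i = 1,2,3)
  Matchable : List (Edge n₁ n₂ n₃) → List (Edge n₁ n₂ n₃) → VSet → Set
  Matchable E 𝓡 W =
    (Σ (Fin (length 𝓡) → Fin n₁) λ f → Injective _≡_ _≡_ f ×
       (∀ i → v₁ (f i) ∈ᵥ W × Adj E (lookup 𝓡 i) (v₁ (f i)))) ×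
    (Σ (Fin (length 𝓡) → Fin n₂) λ f → Injective _≡_ _≡_ f ×
       (∀ i → v₂ (f i) ∈ᵥ W × Adj E (lookup 𝓡 i) (v₂ (f i)))) ×
    (Σ (Fin (length 𝓡) → Fin n₃) λ f → Injective _≡_ _≡_ f ×
       (∀ i → v₃ (f i) ∈ᵥ W × Adj E (lookup 𝓡 i) (v₃ (f i))))

  EdgeHome : List (Edge n₁ n₂ n₃) → List FBlock → List (Edge n₁ n₂ n₃) → Set
  EdgeHome E 𝓕 𝓡 = ∀ e → e LM.∈ E →
    (∃[ F ] (F LM.∈ 𝓕 × e ⊆F F)) ⊎ (∃[ R ] (R LM.∈ 𝓡 × TwoOf e R))

  IsHomeBase : List (Edge n₁ n₂ n₃) → List FBlock → List (Edge n₁ n₂ n₃) → VSet → Set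
  IsHomeBase E 𝓕 𝓡 W =
    IsFRPartition E 𝓕 𝓡 W × Matchable E 𝓡 W × EdgeHome E 𝓕 𝓡

-- Upper bound: the vertices a, x of every F ∈ 𝓕 together with r₁, r₂ of every R ∈ 𝓡 meet every
-- edge by the edge-home property, so τ ≤ 2(|𝓕| + |𝓡|) = 2ν.
-- Lower bound: every vertex of a truncated Fano plane misses one of its edges, so a cover contains
-- two vertices of each F.  For R = r₁r₂r₃ with matched vertices w₁, w₂, w₃ the edges w₁r₂r₃,
-- r₁w₂r₃, r₁r₂w₃ are present and again no vertex meets all of them, so a cover contains two vertices
-- of R ∪ {w₁, w₂, w₃}.  These ν regions are pairwise disjoint, so τ ≥ 2ν.
module Submission where

open import Defs
open import Data.Nat using (ℕ; suc; _+_; _*_; _≤_; z≤n; s≤s)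
open import Data.Nat.Properties
  using (≤-trans; ≤-reflexive; ≤-antisym; +-suc; *-suc; +-identityʳ;
         +-monoˡ-≤; +-monoʳ-≤; +-mono-≤)
open import Data.Nat.Tactic.RingSolver using (solve-∀)
open import Data.Fin using (Fin; zero; suc; splitAt; join) renaming (_≟_ to _≟ᶠ_)
open import Data.Fin.Properties using (join-splitAt)
open import Data.Fin.Subset using (Subset; _∈_; ∣_∣; ⁅_⁆; _∪_; _-_; inside; outside)
  renaming (⊥ to ∅)
open import Data.Fin.Subset.Properties
  using (x∈⁅x⁆; x∈p∪q⁺; ∣⊥∣≡0; ∪-identityˡ; ∣p∣≤∣x∷p∣; x∈p∧x≢y⇒x∈p-y; x∈p⇒∣p-x∣<∣p∣)
open import Data.Vec using (_∷_)
open import Data.Product using (_×_; ∃-syntax; _,_; proj₁; proj₂)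
open import Data.Sum using (_⊎_; inj₁; inj₂; map₁; map₂)
open import Data.Empty using (⊥; ⊥-elim)
open import Data.List using (List; []; _∷_; length; lookup; map; tabulate; _++_)
open import Data.List.Properties using (length-map; length-++; length-tabulate)
open import Data.List.Membership.Propositional using () renaming (_∈_ to _∈ᴸ_)
open import Data.List.Membership.Propositional.Properties
  using (∈-map⁺; ∈-++⁺ˡ; ∈-++⁺ʳ; ∈-tabulate⁻; ∈-lookup)
open import Data.List.Relation.Unary.Any using (here; there)
open import Data.List.Relation.Unary.All as All using (All; []; _∷_)
import Data.List.Relation.Unary.All.Properties as Allₚ
open import Data.List.Relation.Unary.Unique.Propositional using (Unique)
open import Data.List.Relation.Unary.AllPairs using (_∷_)
import Data.List.Relation.Unary.Unique.Propositional.Properties as Unique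
open import Function using (_∘_)
open import Function.Definitions using (Injective)
open import Relation.Binary.PropositionalEquality
  using (_≡_; _≢_; refl; sym; trans; cong; cong₂; subst; ≢-sym)
open import Relation.Nullary using (yes; no; ¬_)

fromList : ∀ {n} → List (Fin n) → Subset n
fromList []       = ∅
fromList (i ∷ is) = ⁅ i ⁆ ∪ fromList is

∣⁅x⁆∪p∣≤1+∣p∣ : ∀ {n} (x : Fin n) (p : Subset n) → ∣ ⁅ x ⁆ ∪ p ∣ ≤ suc ∣ p ∣
∣⁅x⁆∪p∣≤1+∣p∣ zero    (s ∷ p)       = s≤s (subst (_≤ ∣ s ∷ p ∣) (cong ∣_∣ (sym (∪-identityˡ p))) (∣p∣≤∣x∷p∣ s p))
∣⁅x⁆∪p∣≤1+∣p∣ (suc x) (inside ∷ p)  = s≤s (∣⁅x⁆∪p∣≤1+∣p∣ x p)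
∣⁅x⁆∪p∣≤1+∣p∣ (suc x) (outside ∷ p) = ∣⁅x⁆∪p∣≤1+∣p∣ x p

∣fromList∣≤length : ∀ {n} (is : List (Fin n)) → ∣ fromList is ∣ ≤ length is
∣fromList∣≤length {n} []       = ≤-reflexive (∣⊥∣≡0 n)
∣fromList∣≤length      (i ∷ is) = ≤-trans (∣⁅x⁆∪p∣≤1+∣p∣ i _) (s≤s (∣fromList∣≤length is))

∈-fromList : ∀ {n} {i : Fin n} {is} → i ∈ᴸ is → i ∈ fromList is
∈-fromList (here refl) = x∈p∪q⁺ (inj₁ (x∈⁅x⁆ _))
∈-fromList (there i∈)  = x∈p∪q⁺ (inj₂ (∈-fromList i∈))

splitAt-injective : ∀ m {n} → Injective _≡_ _≡_ (splitAt m {n})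
splitAt-injective m {n} {i} {j} eq =
  trans (sym (join-splitAt m n i)) (trans (cong (join m n) eq) (join-splitAt m n j))

module _ {n₁ n₂ n₃ : ℕ} where

  private
    V : Set
    V = Vtx {n₁} {n₂} {n₃}
    VS : Set
    VS = VSet {n₁} {n₂} {n₃}
    Ed : Set
    Ed = Edge n₁ n₂ n₃
    FB : Set
    FB = FBlock {n₁} {n₂} {n₃}

  open FBlock

  remove : V → VS → VS
  remove (v₁ u) (S₁ , S₂ , S₃) = (S₁ - u , S₂ , S₃)
  remove (v₂ u) (S₁ , S₂ , S₃) = (S₁ , S₂ - u , S₃)
  remove (v₃ u) (S₁ , S₂ , S₃) = (S₁ , S₂ , S₃ - u)

  size-remove : ∀ v S → v ∈ᵥ S → suc (size (remove v S)) ≤ size S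
  size-remove (v₁ u) (S₁ , S₂ , S₃) u∈ = +-monoˡ-≤ ∣ S₃ ∣ (+-monoˡ-≤ ∣ S₂ ∣ (x∈p⇒∣p-x∣<∣p∣ u∈))
  size-remove (v₂ u) (S₁ , S₂ , S₃) u∈ =
    ≤-trans (≤-reflexive (cong (_+ ∣ S₃ ∣) (sym (+-suc ∣ S₁ ∣ _))))
            (+-monoˡ-≤ ∣ S₃ ∣ (+-monoʳ-≤ ∣ S₁ ∣ (x∈p⇒∣p-x∣<∣p∣ u∈)))
  size-remove (v₃ u) (S₁ , S₂ , S₃) u∈ =
    ≤-trans (≤-reflexive (sym (+-suc (∣ S₁ ∣ + ∣ S₂ ∣) _)))
            (+-monoʳ-≤ (∣ S₁ ∣ + ∣ S₂ ∣) (x∈p⇒∣p-x∣<∣p∣ u∈))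

  ∈-remove : ∀ w v S → w ∈ᵥ S → w ≢ v → w ∈ᵥ remove v S
  ∈-remove (v₁ _) (v₁ _) (_ , _ , _) w∈ w≢v = x∈p∧x≢y⇒x∈p-y w∈ (λ eq → w≢v (cong v₁ eq))
  ∈-remove (v₂ _) (v₂ _) (_ , _ , _) w∈ w≢v = x∈p∧x≢y⇒x∈p-y w∈ (λ eq → w≢v (cong v₂ eq))
  ∈-remove (v₃ _) (v₃ _) (_ , _ , _) w∈ w≢v = x∈p∧x≢y⇒x∈p-y w∈ (λ eq → w≢v (cong v₃ eq))
  ∈-remove (v₁ _) (v₂ _) (_ , _ , _) w∈ _ = w∈
  ∈-remove (v₁ _) (v₃ _) (_ , _ , _) w∈ _ = w∈
  ∈-remove (v₂ _) (v₁ _) (_ , _ , _) w∈ _ = w∈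
  ∈-remove (v₂ _) (v₃ _) (_ , _ , _) w∈ _ = w∈
  ∈-remove (v₃ _) (v₁ _) (_ , _ , _) w∈ _ = w∈
  ∈-remove (v₃ _) (v₂ _) (_ , _ , _) w∈ _ = w∈

  unique⇒length≤size : ∀ S (vs : List V) → Unique vs → All (_∈ᵥ S) vs → length vs ≤ size S
  unique⇒length≤size S []       _             _           = z≤n
  unique⇒length≤size S (v ∷ vs) (v∉vs ∷ !vs) (v∈S ∷ vs⊆S) =
    ≤-trans (s≤s (unique⇒length≤size (remove v S) vs !vs vs⊆S-v)) (size-remove v S v∈S)
    where
    vs⊆S-v : All (_∈ᵥ remove v S) vs
    vs⊆S-v = All.zipWith (λ (v≢w , w∈S) → ∈-remove _ v S w∈S (≢-sym v≢w)) (v∉vs , vs⊆S)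

  record TwoIn (C : VS) (P : V → Set) : Set where
    constructor twoIn
    field
      {u u'} : V
      u≢u'   : u ≢ u'
      u∈C    : u ∈ᵥ C
      u'∈C   : u' ∈ᵥ C
      Pu     : P u
      Pu'    : P u'

  mapTwoIn : ∀ {C P Q} → (∀ {v} → P v → Q v) → TwoIn C P → TwoIn C Q
  mapTwoIn f (twoIn u≢u' u∈C u'∈C Pu Pu') = twoIn u≢u' u∈C u'∈C (f Pu) (f Pu')

  disjoint-regions⇒2*N≤size : ∀ {N} (C : VS) (Region : Fin N → V → Set) →
    (∀ {i j v} → Region i v → Region j v → i ≡ j) →
    ((i : Fin N) → TwoIn C (Region i)) →
    2 * N ≤ size C
  disjoint-regions⇒2*N≤size {N} C Region disjoint two =
    subst (_≤ size C) length-vs (unique⇒length≤size C vs unique-vs vs⊆C)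
    where
    first second : Fin N → V
    first  i = TwoIn.u  (two i)
    second i = TwoIn.u' (two i)

    vs : List V
    vs = tabulate first ++ tabulate second

    injective : ∀ {f g : Fin N → V} → (∀ i → Region i (f i)) → (∀ i → Region i (g i)) →
      ∀ {i j} → f i ≡ g j → i ≡ j
    injective f∈ g∈ {i} {j} eq = disjoint (f∈ i) (subst (Region j) (sym eq) (g∈ j))

    unique-vs : Unique vs
    unique-vs = Unique.++⁺
      (Unique.tabulate⁺ (injective (TwoIn.Pu ∘ two) (TwoIn.Pu ∘ two)))
      (Unique.tabulate⁺ (injective (TwoIn.Pu' ∘ two) (TwoIn.Pu' ∘ two)))
      λ (∈first , ∈second) → separate (∈-tabulate⁻ ∈first) (∈-tabulate⁻ ∈second)
      where
      separate : ∀ {v} → ∃[ i ] v ≡ first i → ∃[ j ] v ≡ second j → ⊥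
      separate (i , refl) (j , eq) with injective (TwoIn.Pu ∘ two) (TwoIn.Pu' ∘ two) eq
      ... | refl = TwoIn.u≢u' (two i) eq

    vs⊆C : All (_∈ᵥ C) vs
    vs⊆C = Allₚ.++⁺ (Allₚ.tabulate⁺ (TwoIn.u∈C ∘ two)) (Allₚ.tabulate⁺ (TwoIn.u'∈C ∘ two))

    length-vs : length vs ≡ 2 * N
    length-vs = trans (length-++ (tabulate first))
      (cong₂ _+_ (length-tabulate first) (trans (length-tabulate second) (sym (+-identityʳ N))))

  ∈ₑ-⊆F⇒∈vertsF : ∀ {B : FB} v e → v ∈ₑ e → e ⊆F B → v ∈ᴸ vertsF B
  ∈ₑ-⊆F⇒∈vertsF (v₁ _) _ refl (inj₁ refl , _) = here refl
  ∈ₑ-⊆F⇒∈vertsF (v₁ _) _ refl (inj₂ refl , _) = there (here refl)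
  ∈ₑ-⊆F⇒∈vertsF (v₂ _) _ refl (_ , inj₁ refl , _) = there (there (here refl))
  ∈ₑ-⊆F⇒∈vertsF (v₂ _) _ refl (_ , inj₂ refl , _) = there (there (there (here refl)))
  ∈ₑ-⊆F⇒∈vertsF (v₃ _) _ refl (_ , _ , inj₁ refl) = there (there (there (there (here refl))))
  ∈ₑ-⊆F⇒∈vertsF (v₃ _) _ refl (_ , _ , inj₂ refl) = there (there (there (there (there (here refl)))))

  AvoidingEdge : List Ed → FB → V → Set
  AvoidingEdge E B u = ∃[ e ] (e ∈ᴸ E × e ⊆F B × ¬ u ∈ₑ e)

  cover-meets-twice : ∀ {E C} {B : FB} {e} → IsCover E C → e ∈ᴸ E → e ⊆F B →
    (∀ u → u ∈ₑ e → AvoidingEdge E B u) → TwoIn C (_∈ᴸ vertsF B)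
  cover-meets-twice {e = e} cover e∈E e⊆B avoid with cover e e∈E
  ... | u , u∈e , u∈C with avoid u u∈e
  ...   | e' , e'∈E , e'⊆B , u∉e' with cover e' e'∈E
  ...     | u' , u'∈e' , u'∈C =
    twoIn (λ { refl → u∉e' u'∈e' }) u∈C u'∈C (∈ₑ-⊆F⇒∈vertsF u e u∈e e⊆B) (∈ₑ-⊆F⇒∈vertsF u' e' u'∈e' e'⊆B)

  fano-meets-twice : ∀ {E C} {F : FB} → IsCover E C → IsMultiFano E F → TwoIn C (_∈ᴸ vertsF F)
  fano-meets-twice cover (a≢x , b≢y , c≢z , _ , abc∈E ∷ ayz∈E ∷ xbz∈E ∷ _ ∷ []) =
    cover-meets-twice cover abc∈E (inj₁ refl , inj₁ refl , inj₁ refl) avoid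
    where
    avoid : ∀ u → u ∈ₑ _ → AvoidingEdge _ _ u
    avoid (v₁ _) refl = _ , xbz∈E , (inj₂ refl , inj₁ refl , inj₂ refl) , a≢x
    avoid (v₂ _) refl = _ , ayz∈E , (inj₁ refl , inj₂ refl , inj₂ refl) , b≢y
    avoid (v₃ _) refl = _ , ayz∈E , (inj₁ refl , inj₂ refl , inj₂ refl) , c≢z

  -- The star of R = r₁r₂r₃ with matched vertices w₁, w₂, w₃, as a 6-set with classes {rᵢ, wᵢ}.
  star-meets-twice : ∀ {E C r₁ w₁ r₂ w₂ r₃ w₃} → IsCover E C →
    r₁ ≢ w₁ → r₂ ≢ w₂ → r₃ ≢ w₃ →
    (w₁ , r₂ , r₃) ∈ᴸ E → (r₁ , w₂ , r₃) ∈ᴸ E → (r₁ , r₂ , w₃) ∈ᴸ E →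
    TwoIn C (_∈ᴸ vertsF (fblock r₁ w₁ r₂ w₂ r₃ w₃))
  star-meets-twice cover r₁≢w₁ r₂≢w₂ r₃≢w₃ e₁∈E e₂∈E e₃∈E =
    cover-meets-twice cover e₁∈E (inj₂ refl , inj₁ refl , inj₁ refl) avoid
    where
    avoid : ∀ u → u ∈ₑ _ → AvoidingEdge _ _ u
    avoid (v₁ _) refl = _ , e₂∈E , (inj₁ refl , inj₂ refl , inj₁ refl) , ≢-sym r₁≢w₁
    avoid (v₂ _) refl = _ , e₂∈E , (inj₁ refl , inj₂ refl , inj₁ refl) , r₂≢w₂
    avoid (v₃ _) refl = _ , e₃∈E , (inj₁ refl , inj₁ refl , inj₂ refl) , r₃≢w₃

  Adj-v₁⇒∈ : ∀ {E : List Ed} {r₁ w₁ r₂ r₃} → r₁ ≢ w₁ → Adj E (r₁ , r₂ , r₃) (v₁ w₁) → (w₁ , r₂ , r₃) ∈ᴸ E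
  Adj-v₁⇒∈ r₁≢w₁ ((_ , _ , _) , e∈E , refl , inj₁ (w₁≡r₁ , _))           = ⊥-elim (r₁≢w₁ (sym w₁≡r₁))
  Adj-v₁⇒∈ r₁≢w₁ ((_ , _ , _) , e∈E , refl , inj₂ (inj₁ (w₁≡r₁ , _)))   = ⊥-elim (r₁≢w₁ (sym w₁≡r₁))
  Adj-v₁⇒∈ r₁≢w₁ ((_ , _ , _) , e∈E , refl , inj₂ (inj₂ (refl , refl))) = e∈E

  Adj-v₂⇒∈ : ∀ {E : List Ed} {r₁ r₂ w₂ r₃} → r₂ ≢ w₂ → Adj E (r₁ , r₂ , r₃) (v₂ w₂) → (r₁ , w₂ , r₃) ∈ᴸ E
  Adj-v₂⇒∈ r₂≢w₂ ((_ , _ , _) , e∈E , refl , inj₁ (_ , w₂≡r₂))           = ⊥-elim (r₂≢w₂ (sym w₂≡r₂))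
  Adj-v₂⇒∈ r₂≢w₂ ((_ , _ , _) , e∈E , refl , inj₂ (inj₁ (refl , refl))) = e∈E
  Adj-v₂⇒∈ r₂≢w₂ ((_ , _ , _) , e∈E , refl , inj₂ (inj₂ (w₂≡r₂ , _)))   = ⊥-elim (r₂≢w₂ (sym w₂≡r₂))

  Adj-v₃⇒∈ : ∀ {E : List Ed} {r₁ r₂ r₃ w₃} → r₃ ≢ w₃ → Adj E (r₁ , r₂ , r₃) (v₃ w₃) → (r₁ , r₂ , w₃) ∈ᴸ E
  Adj-v₃⇒∈ r₃≢w₃ ((_ , _ , _) , e∈E , refl , inj₁ (refl , refl))         = e∈E
  Adj-v₃⇒∈ r₃≢w₃ ((_ , _ , _) , e∈E , refl , inj₂ (inj₁ (_ , w₃≡r₃)))   = ⊥-elim (r₃≢w₃ (sym w₃≡r₃))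
  Adj-v₃⇒∈ r₃≢w₃ ((_ , _ , _) , e∈E , refl , inj₂ (inj₂ (_ , w₃≡r₃)))   = ⊥-elim (r₃≢w₃ (sym w₃≡r₃))

  matched-meets-twice : ∀ {E C} (R w : Ed) → IsCover E C →
    (∀ v → v ∈ᴸ vertsR R → ¬ v ∈ₑ w) →
    Adj E R (v₁ (proj₁ w)) → Adj E R (v₂ (proj₁ (proj₂ w))) → Adj E R (v₃ (proj₂ (proj₂ w))) →
    TwoIn C (λ v → v ∈ᴸ vertsR R ⊎ v ∈ₑ w)
  matched-meets-twice (r₁ , r₂ , r₃) (w₁ , w₂ , w₃) cover R∩w=∅ adj₁ adj₂ adj₃ =
    mapTwoIn split-star
      (star-meets-twice cover r₁≢w₁ r₂≢w₂ r₃≢w₃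
        (Adj-v₁⇒∈ r₁≢w₁ adj₁) (Adj-v₂⇒∈ r₂≢w₂ adj₂) (Adj-v₃⇒∈ r₃≢w₃ adj₃))
    where
    r₁≢w₁ : r₁ ≢ w₁
    r₁≢w₁ r₁≡w₁ = R∩w=∅ (v₁ r₁) (here refl) r₁≡w₁
    r₂≢w₂ : r₂ ≢ w₂
    r₂≢w₂ r₂≡w₂ = R∩w=∅ (v₂ r₂) (there (here refl)) r₂≡w₂
    r₃≢w₃ : r₃ ≢ w₃
    r₃≢w₃ r₃≡w₃ = R∩w=∅ (v₃ r₃) (there (there (here refl))) r₃≡w₃

    split-star : ∀ {v} → v ∈ᴸ vertsF (fblock r₁ w₁ r₂ w₂ r₃ w₃) →
      v ∈ᴸ vertsR (r₁ , r₂ , r₃) ⊎ v ∈ₑ (w₁ , w₂ , w₃)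
    split-star (here refl)                                         = inj₁ (here refl)
    split-star (there (here refl))                                 = inj₂ refl
    split-star (there (there (here refl)))                         = inj₁ (there (here refl))
    split-star (there (there (there (here refl))))                 = inj₂ refl
    split-star (there (there (there (there (here refl)))))         = inj₁ (there (there (here refl)))
    split-star (there (there (there (there (there (here refl)))))) = inj₂ refl

  blockVerts : (𝓕 : List FB) (𝓡 : List Ed) → Fin (length 𝓕) ⊎ Fin (length 𝓡) → List V
  blockVerts 𝓕 𝓡 (inj₁ j) = vertsF (lookup 𝓕 j)
  blockVerts 𝓕 𝓡 (inj₂ r) = vertsR (lookup 𝓡 r)

  blockIndex : (𝓕 : List FB) (𝓡 : List Ed) →
    Fin (length 𝓕) ⊎ Fin (length 𝓡) → Fin (length (blocks 𝓕 𝓡))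
  blockIndex (F ∷ 𝓕) 𝓡       (inj₁ zero)    = zero
  blockIndex (F ∷ 𝓕) 𝓡       (inj₁ (suc j)) = suc (blockIndex 𝓕 𝓡 (inj₁ j))
  blockIndex (F ∷ 𝓕) 𝓡       (inj₂ r)       = suc (blockIndex 𝓕 𝓡 (inj₂ r))
  blockIndex []      (R ∷ 𝓡) (inj₂ zero)    = zero
  blockIndex []      (R ∷ 𝓡) (inj₂ (suc r)) = suc (blockIndex [] 𝓡 (inj₂ r))

  blockOf : (𝓕 : List FB) (𝓡 : List Ed) →
    Fin (length (blocks 𝓕 𝓡)) → Fin (length 𝓕) ⊎ Fin (length 𝓡)
  blockOf (F ∷ 𝓕) 𝓡       zero    = inj₁ zero
  blockOf (F ∷ 𝓕) 𝓡       (suc i) = map₁ suc (blockOf 𝓕 𝓡 i)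
  blockOf []      (R ∷ 𝓡) zero    = inj₂ zero
  blockOf []      (R ∷ 𝓡) (suc i) = map₂ suc (blockOf [] 𝓡 i)

  blockOf-blockIndex : ∀ 𝓕 𝓡 p → blockOf 𝓕 𝓡 (blockIndex 𝓕 𝓡 p) ≡ p
  blockOf-blockIndex (F ∷ 𝓕) 𝓡       (inj₁ zero)    = refl
  blockOf-blockIndex (F ∷ 𝓕) 𝓡       (inj₁ (suc j)) = cong (map₁ suc) (blockOf-blockIndex 𝓕 𝓡 (inj₁ j))
  blockOf-blockIndex (F ∷ 𝓕) 𝓡       (inj₂ r)       = cong (map₁ suc) (blockOf-blockIndex 𝓕 𝓡 (inj₂ r))
  blockOf-blockIndex []      (R ∷ 𝓡) (inj₂ zero)    = refl
  blockOf-blockIndex []      (R ∷ 𝓡) (inj₂ (suc r)) = cong (map₂ suc) (blockOf-blockIndex [] 𝓡 (inj₂ r))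

  blockIndex-injective : ∀ 𝓕 𝓡 → Injective _≡_ _≡_ (blockIndex 𝓕 𝓡)
  blockIndex-injective 𝓕 𝓡 {p} {p'} eq =
    trans (sym (blockOf-blockIndex 𝓕 𝓡 p)) (trans (cong (blockOf 𝓕 𝓡) eq) (blockOf-blockIndex 𝓕 𝓡 p'))

  lookup-blockIndex : ∀ 𝓕 𝓡 p → lookup (blocks 𝓕 𝓡) (blockIndex 𝓕 𝓡 p) ≡ blockVerts 𝓕 𝓡 p
  lookup-blockIndex (F ∷ 𝓕) 𝓡       (inj₁ zero)    = refl
  lookup-blockIndex (F ∷ 𝓕) 𝓡       (inj₁ (suc j)) = lookup-blockIndex 𝓕 𝓡 (inj₁ j)
  lookup-blockIndex (F ∷ 𝓕) 𝓡       (inj₂ r)       = lookup-blockIndex 𝓕 𝓡 (inj₂ r)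
  lookup-blockIndex []      (R ∷ 𝓡) (inj₂ zero)    = refl
  lookup-blockIndex []      (R ∷ 𝓡) (inj₂ (suc r)) = lookup-blockIndex [] 𝓡 (inj₂ r)

  fanoFirstClass : List FB → List (Fin n₁)
  fanoFirstClass []      = []
  fanoFirstClass (F ∷ 𝓕) = a F ∷ x F ∷ fanoFirstClass 𝓕

  length-fanoFirstClass : ∀ 𝓕 → length (fanoFirstClass 𝓕) ≡ 2 * length 𝓕
  length-fanoFirstClass []      = refl
  length-fanoFirstClass (F ∷ 𝓕) =
    trans (cong (2 +_) (length-fanoFirstClass 𝓕)) (sym (*-suc 2 (length 𝓕)))

  ∈-fanoFirstClass : ∀ {F 𝓕 u} → F ∈ᴸ 𝓕 → u ≡ a F ⊎ u ≡ x F → u ∈ᴸ fanoFirstClass 𝓕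
  ∈-fanoFirstClass (here refl) (inj₁ refl) = here refl
  ∈-fanoFirstClass (here refl) (inj₂ refl) = there (here refl)
  ∈-fanoFirstClass (there F∈) u∈F          = there (there (∈-fanoFirstClass F∈ u∈F))

  homeCover : List FB → List Ed → VS
  homeCover 𝓕 𝓡 = fromList (fanoFirstClass 𝓕 ++ map proj₁ 𝓡) , fromList (map (proj₁ ∘ proj₂) 𝓡) , ∅

  homeCover-covers : ∀ {E 𝓕 𝓡} → EdgeHome E 𝓕 𝓡 → IsCover E (homeCover 𝓕 𝓡)
  homeCover-covers {𝓕 = 𝓕} home (e₁ , e₂ , e₃) e∈E with home _ e∈E
  ... | inj₁ (F , F∈𝓕 , e₁∈F , _) = v₁ e₁ , refl , ∈-fromList (∈-++⁺ˡ (∈-fanoFirstClass F∈𝓕 e₁∈F))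
  ... | inj₂ (_ , R∈𝓡 , inj₁ (refl , _))        = v₁ e₁ , refl , ∈-fromList (∈-++⁺ʳ (fanoFirstClass 𝓕) (∈-map⁺ proj₁ R∈𝓡))
  ... | inj₂ (_ , R∈𝓡 , inj₂ (inj₁ (refl , _))) = v₁ e₁ , refl , ∈-fromList (∈-++⁺ʳ (fanoFirstClass 𝓕) (∈-map⁺ proj₁ R∈𝓡))
  ... | inj₂ (_ , R∈𝓡 , inj₂ (inj₂ (refl , _))) = v₂ e₂ , refl , ∈-fromList (∈-map⁺ (proj₁ ∘ proj₂) R∈𝓡)

  size-homeCover : ∀ 𝓕 𝓡 → size (homeCover 𝓕 𝓡) ≤ 2 * (length 𝓕 + length 𝓡)
  size-homeCover 𝓕 𝓡 =
    ≤-trans (+-mono-≤ (+-mono-≤ (∣fromList∣≤length first) (∣fromList∣≤length second)) (≤-reflexive (∣⊥∣≡0 n₃)))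
            (≤-reflexive lengths)
    where
    first : List (Fin n₁)
    first = fanoFirstClass 𝓕 ++ map proj₁ 𝓡
    second : List (Fin n₂)
    second = map (proj₁ ∘ proj₂) 𝓡
    lengths : length first + length second + 0 ≡ 2 * (length 𝓕 + length 𝓡)
    lengths
      rewrite length-++ (fanoFirstClass 𝓕) {map proj₁ 𝓡} | length-fanoFirstClass 𝓕
            | length-map proj₁ 𝓡 | length-map (proj₁ ∘ proj₂) 𝓡
      = arithmetic (length 𝓕) (length 𝓡)
      where
      arithmetic : ∀ m k → 2 * m + k + k + 0 ≡ 2 * (m + k)
      arithmetic = solve-∀

  module _ {E : List Ed} {𝓕 : List FB} {𝓡 : List Ed} {W : VS} where

    matchedTriple : Matchable E 𝓡 W → Fin (length 𝓡) → Ed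
    matchedTriple ((f₁ , _) , (f₂ , _) , (f₃ , _)) r = f₁ r , f₂ r , f₃ r

    matchedTriple-injective : ∀ (M : Matchable E 𝓡 W) {r r'} v →
      v ∈ₑ matchedTriple M r → v ∈ₑ matchedTriple M r' → r ≡ r'
    matchedTriple-injective ((_ , f₁-inj , _) , _) (v₁ _) refl eq = f₁-inj eq
    matchedTriple-injective (_ , (_ , f₂-inj , _) , _) (v₂ _) refl eq = f₂-inj eq
    matchedTriple-injective (_ , _ , (_ , f₃-inj , _)) (v₃ _) refl eq = f₃-inj eq

    matchedTriple⊆W : ∀ (M : Matchable E 𝓡 W) r v → v ∈ₑ matchedTriple M r → v ∈ᵥ W
    matchedTriple⊆W ((_ , _ , f₁-ok) , _) r (v₁ _) refl = proj₁ (f₁-ok r)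
    matchedTriple⊆W (_ , (_ , _ , f₂-ok) , _) r (v₂ _) refl = proj₁ (f₂-ok r)
    matchedTriple⊆W (_ , _ , (_ , _ , f₃-ok)) r (v₃ _) refl = proj₁ (f₃-ok r)

    block∩W=∅ : IsPartition 𝓕 𝓡 W → ∀ p v → v ∈ᴸ blockVerts 𝓕 𝓡 p → ¬ v ∈ᵥ W
    block∩W=∅ (_ , _ , blocks∩W=∅) p v v∈p =
      blocks∩W=∅ (blockIndex 𝓕 𝓡 p) v (subst (v ∈ᴸ_) (sym (lookup-blockIndex 𝓕 𝓡 p)) v∈p)

    blocks-disjoint : IsPartition 𝓕 𝓡 W → ∀ p p' {v} →
      v ∈ᴸ blockVerts 𝓕 𝓡 p → v ∈ᴸ blockVerts 𝓕 𝓡 p' → p ≡ p'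
    blocks-disjoint (_ , disjoint , _) p p' {v} v∈p v∈p' with blockIndex 𝓕 𝓡 p ≟ᶠ blockIndex 𝓕 𝓡 p'
    ... | yes eq = blockIndex-injective 𝓕 𝓡 eq
    ... | no neq = ⊥-elim (disjoint _ _ neq v (in-block p v∈p) (in-block p' v∈p'))
      where
      in-block : ∀ q → v ∈ᴸ blockVerts 𝓕 𝓡 q → v ∈ᴸ lookup (blocks 𝓕 𝓡) (blockIndex 𝓕 𝓡 q)
      in-block q = subst (v ∈ᴸ_) (sym (lookup-blockIndex 𝓕 𝓡 q))

    MatchedTo : Matchable E 𝓡 W → Fin (length 𝓕) ⊎ Fin (length 𝓡) → V → Set
    MatchedTo M (inj₁ _) v = ⊥
    MatchedTo M (inj₂ r) v = v ∈ₑ matchedTriple M r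

    Region : Matchable E 𝓡 W → Fin (length 𝓕) ⊎ Fin (length 𝓡) → V → Set
    Region M p v = v ∈ᴸ blockVerts 𝓕 𝓡 p ⊎ MatchedTo M p v

    regions-disjoint : IsPartition 𝓕 𝓡 W → ∀ M p p' {v} → Region M p v → Region M p' v → p ≡ p'
    regions-disjoint P M p        p'       (inj₁ v∈p) (inj₁ v∈p') = blocks-disjoint P p p' v∈p v∈p'
    regions-disjoint P M p        (inj₂ r) (inj₁ v∈p) (inj₂ v∈r)  =
      ⊥-elim (block∩W=∅ P p _ v∈p (matchedTriple⊆W M r _ v∈r))
    regions-disjoint P M (inj₂ r) p'       (inj₂ v∈r) (inj₁ v∈p') =
      ⊥-elim (block∩W=∅ P p' _ v∈p' (matchedTriple⊆W M r _ v∈r))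
    regions-disjoint P M (inj₂ r) (inj₂ r') {v} (inj₂ v∈r) (inj₂ v∈r') =
      cong inj₂ (matchedTriple-injective M v v∈r v∈r')

    region-meets-twice : ∀ {C} → IsCover E C → All (IsMultiFano E) 𝓕 → IsPartition 𝓕 𝓡 W →
      ∀ M p → TwoIn C (Region M p)
    region-meets-twice cover fanos P M (inj₁ j) =
      mapTwoIn inj₁ (fano-meets-twice cover (All.lookup fanos (∈-lookup j)))
    region-meets-twice cover fanos P M@((_ , _ , f₁-ok) , (_ , _ , f₂-ok) , (_ , _ , f₃-ok)) (inj₂ r) =
      matched-meets-twice (lookup 𝓡 r) (matchedTriple M r) cover
        (λ v v∈R v∈w → block∩W=∅ P (inj₂ r) v v∈R (matchedTriple⊆W M r v v∈w))
        (proj₂ (f₁-ok r)) (proj₂ (f₂-ok r)) (proj₂ (f₃-ok r))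

    homeBase⇒2*[|𝓕|+|𝓡|]≤size : ∀ {C} → IsHomeBase E 𝓕 𝓡 W → IsCover E C →
      2 * (length 𝓕 + length 𝓡) ≤ size C
    homeBase⇒2*[|𝓕|+|𝓡|]≤size {C} ((P , fanos , _) , M , _) cover =
      disjoint-regions⇒2*N≤size C (λ i → Region M (splitAt (length 𝓕) i))
        (λ {i} {j} v∈i v∈j → splitAt-injective (length 𝓕) (regions-disjoint P M _ _ v∈i v∈j))
        (λ i → region-meets-twice cover fanos P M (splitAt (length 𝓕) i))

proposition1p8 : (H : Hypergraph) →
    let open Hypergraph H in
    (𝓕 : List (FBlock {n₁} {n₂} {n₃})) (𝓡 : List (Edge n₁ n₂ n₃)) (W : VSet {n₁} {n₂} {n₃}) →
    IsHomeBase edges 𝓕 𝓡 W →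
    (ν τ : ℕ) → IsMatchingNumber edges ν → IsCoverNumber edges τ →
    τ ≡ 2 * ν
proposition1p8 (hyp _ _ _ E) 𝓕 𝓡 W home-base@((_ , _ , |𝓕|+|𝓡|≡ν) , _ , edge-home) ν τ is-ν
               ((C , C-covers , size-C≡τ) , τ-minimal) =
  subst (λ n → τ ≡ 2 * n) (|𝓕|+|𝓡|≡ν ν is-ν) (≤-antisym τ≤ τ≥)
  where
  τ≤ : τ ≤ 2 * (length 𝓕 + length 𝓡)
  τ≤ = ≤-trans (τ-minimal _ (homeCover-covers edge-home)) (size-homeCover 𝓕 𝓡)
  τ≥ : 2 * (length 𝓕 + length 𝓡) ≤ τ
  τ≥ = subst (_ ≤_) size-C≡τ (homeBase⇒2*[|𝓕|+|𝓡|]≤size home-base C-covers)
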